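{- The matching $M$ on $\Gamma(m,n)$ defined below is an acyclic partial matching on its Hasse diagram: there is no sequence of distinct elements $T_1,\dots,T_r$, $r\ge2$, with $T_1\lessdot u(T_1)\gtrdot T_2\lessdot u(T_2)\gtrdot\cdots\gtrdot T_r\lessdot u(T_r)\gtrdot T_1$.
   Context: The staircase board of length $m$ consists of squares $(i,j)$, $i,j\ge1$, $i+j\le m$ (row $i$ from top, column $j$ from left); square $(i,j)$ is shaded if $m-i-j$ (the number of squares below it in its column) is even. $\mathcal R(m,n)$ is the set of placements of $n$ rooks with no two in the same column. $\Gamma(m,n)$ is the poset on $\mathcal R(m,n)$ generated by covers $T\lessdot T'$ when $T'\in\mathcal R(m,n)$ arises from $T$ by moving one rook one square up or one square left. The matching: for $T$, let $r$ be the leftmost rook of $T$ that is not on a shaded square of row $1$. If $r$ is on an unshaded square, match $T$ with the placement obtained by moving $r$ down one square (then $T=u(\cdot)$ of that placement); if $r$ is on a shaded square not in row $1$, match $T$ with $u(T)$, obtained by moving $r$ up one square. Placements with all rooks on shaded squares of row $1$ are unmatched. -}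

module Defs where

open import Data.Nat using (ℕ; zero; suc; _+_; _∸_; _≤_)
open import Data.Bool using (Bool; true; false; if_then_else_; _∧_)
open import Data.Maybe using (Maybe; just; nothing)
import Data.Maybe as Maybe
open import Data.Vec using (Vec; []; _∷_)
open import Data.Product using (_×_)
open import Data.Unit using (⊤)
open import Relation.Binary.PropositionalEquality using (_≡_)

-- A rook placement on the staircase board of length m is encoded column by
-- column: a vector of length m whose entry at position j (columns numbered
-- 1..m from the left) is  nothing  (no rook in column j) or  just i  (a rook
-- on square (i , j), row i counted from the top, starting at 1).
-- This encoding builds in "no two rooks in the same column".
Placement : ℕ → Set
Placement m = Vec (Maybe ℕ) m

OnBoard : ℕ → ℕ → {k : ℕ} → Vec (Maybe ℕ) k → Set
OnBoard m j [] = ⊤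
OnBoard m j (nothing ∷ xs) = OnBoard m (suc j) xs
OnBoard m j (just i ∷ xs) = (1 ≤ i) × (i + j ≤ m) × OnBoard m (suc j) xs

rooks : {k : ℕ} → Vec (Maybe ℕ) k → ℕ
rooks [] = 0
rooks (nothing ∷ xs) = rooks xs
rooks (just _ ∷ xs) = suc (rooks xs)

InR : (m n : ℕ) → Placement m → Set
InR m n T = OnBoard m 1 T × (rooks T ≡ n)

isEven : ℕ → Bool
isEven zero = true
isEven (suc zero) = false
isEven (suc (suc k)) = isEven k

shaded : ℕ → ℕ → ℕ → Bool
shaded m i j = isEven (m ∸ i ∸ j)

isOne : ℕ → Bool
isOne (suc zero) = true
isOne _ = false

atLeastTwo : ℕ → Bool
atLeastTwo (suc (suc _)) = true
atLeastTwo _ = false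

data Step : {k : ℕ} → Vec (Maybe ℕ) k → Vec (Maybe ℕ) k → Set where
  up    : ∀ {k i} {xs : Vec (Maybe ℕ) k} →
          Step (just (suc i) ∷ xs) (just i ∷ xs)
  left  : ∀ {k i} {xs : Vec (Maybe ℕ) k} →
          Step (nothing ∷ just i ∷ xs) (just i ∷ nothing ∷ xs)
  there : ∀ {k x} {xs ys : Vec (Maybe ℕ) k} →
          Step xs ys → Step (x ∷ xs) (x ∷ ys)

Cover : (m n : ℕ) → Placement m → Placement m → Set
Cover m n T T' = InR m n T × InR m n T' × Step T T'

uGo : ℕ → ℕ → {k : ℕ} → Vec (Maybe ℕ) k → Maybe (Vec (Maybe ℕ) k)
uGo m j [] = nothing
uGo m j (nothing ∷ xs) = Maybe.map (nothing ∷_) (uGo m (suc j) xs)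
uGo m j (just i ∷ xs) =
  if isOne i ∧ shaded m i j
  then Maybe.map (just i ∷_) (uGo m (suc j) xs)
  else (if atLeastTwo i ∧ shaded m i j
        then just (just (i ∸ 1) ∷ xs)
        else nothing)

-- the partial map u : T ↦ u(T) (defined exactly when T is matched upward)
u : (m : ℕ) → Placement m → Maybe (Placement m)
u m T = uGo m 1 T

module Submission where

-- For a placement T, call the column of the leftmost rook of T
-- that is not parked on a shaded square of row 1 its pivot column; when T is
-- matched upwards, u(T) moves exactly that rook one square up.  The key fact:
--
--   if u(T) = U, another placement T' ≠ T is covered by U and u(T') exists,
--   then the pivot column of T' lies strictly to the right of that of T.
--
-- Among the moves producing U from T', a move left of the pivot column or a
-- move right of it leaves T' with a rook on an unshaded square where the scan
-- of u stops, so u(T') would not exist (the shading alternates between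
-- vertically and horizontally adjacent squares); moving the raised rook up
-- gives back T; the only remaining move brings a rook into the pivot column
-- from the right.  Along an alternating cycle T₁ ⋖ u(T₁) ⋗ T₂ ⋖ ⋯ ⋗ T₁ the
-- pivot column would therefore strictly increase all the way round, which is
-- impossible.

open import Defs
open import Data.Nat using (ℕ; zero; suc; _<_; _≤_; _+_; _∸_; z≤n; s≤s)
open import Data.Nat.Properties
  using (∸-+-assoc; +-suc; ≤-refl; <-trans; <-irrefl; <⇒≤; 1+n≢n; 1+n≰n; m≤n⇒m<n∨m≡n)
open import Data.Bool using (true; false; not; if_then_else_)
open import Data.Maybe using (Maybe; just; nothing)
open import Data.Vec using (Vec; []; _∷_)
open import Data.Product using (Σ; _×_; _,_; proj₁; proj₂)
open import Data.Sum using (inj₁; inj₂)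
open import Data.Empty using (⊥; ⊥-elim)
open import Function using (_∘_)
open import Relation.Nullary using (¬_)
open import Relation.Binary.PropositionalEquality
  using (_≡_; _≢_; refl; sym; trans; cong; module ≡-Reasoning)

isEven-suc : ∀ n → isEven (suc n) ≡ not (isEven n)
isEven-suc zero          = refl
isEven-suc (suc zero)    = refl
isEven-suc (suc (suc n)) = isEven-suc n

isEven-∸-suc : ∀ {m k} → k < m → isEven (m ∸ k) ≡ not (isEven (m ∸ suc k))
isEven-∸-suc {suc m} {zero}  _         = isEven-suc m
isEven-∸-suc {suc m} {suc k} (s≤s k<m) = isEven-∸-suc k<m

shaded-antidiagonal : ∀ m i j → shaded m i j ≡ isEven (m ∸ (i + j))
shaded-antidiagonal m i j = cong isEven (∸-+-assoc m i j)

shaded-right≡below : ∀ m i j → shaded m i (suc j) ≡ shaded m (suc i) j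
shaded-right≡below m i j = begin
  shaded m i (suc j)         ≡⟨ shaded-antidiagonal m i (suc j) ⟩
  isEven (m ∸ (i + suc j))   ≡⟨ cong (isEven ∘ (m ∸_)) (+-suc i j) ⟩
  isEven (m ∸ suc (i + j))   ≡⟨ sym (shaded-antidiagonal m (suc i) j) ⟩
  shaded m (suc i) j         ∎
  where open ≡-Reasoning

shaded-vertical : ∀ {m i j} → suc i + j ≤ m → shaded m i j ≡ not (shaded m (suc i) j)
shaded-vertical {m} {i} {j} onBoard = begin
  shaded m i j                     ≡⟨ shaded-antidiagonal m i j ⟩
  isEven (m ∸ (i + j))             ≡⟨ isEven-∸-suc onBoard ⟩
  not (isEven (m ∸ suc (i + j)))   ≡⟨ cong not (sym (shaded-antidiagonal m (suc i) j)) ⟩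
  not (shaded m (suc i) j)         ∎
  where open ≡-Reasoning

not-both-shaded : ∀ {m} i j → suc i + j ≤ m →
                  shaded m i j ≡ true → shaded m (suc i) j ≡ true → ⊥
not-both-shaded {m} i j onBoard upper lower = true≢false (begin
  true                       ≡⟨ sym upper ⟩
  shaded m i j               ≡⟨ shaded-vertical {m} {i} {j} onBoard ⟩
  not (shaded m (suc i) j)   ≡⟨ cong not lower ⟩
  false                      ∎)
  where
  open ≡-Reasoning
  true≢false : true ≢ false
  true≢false ()

data Raises (m : ℕ) : ℕ → {k : ℕ} → Vec (Maybe ℕ) k → Vec (Maybe ℕ) k → Set where
  pass-empty  : ∀ {j k} {xs ys : Vec (Maybe ℕ) k} →
                Raises m (suc j) xs ys → Raises m j (nothing ∷ xs) (nothing ∷ ys)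
  pass-parked : ∀ {j k} {xs ys : Vec (Maybe ℕ) k} → shaded m 1 j ≡ true →
                Raises m (suc j) xs ys → Raises m j (just 1 ∷ xs) (just 1 ∷ ys)
  raise       : ∀ {j k i} {xs : Vec (Maybe ℕ) k} → shaded m (suc (suc i)) j ≡ true →
                Raises m j (just (suc (suc i)) ∷ xs) (just (suc i) ∷ xs)

uGo-raises : ∀ {m j k} (T : Vec (Maybe ℕ) k) {U} → uGo m j T ≡ just U → Raises m j T U
uGo-raises []                  ()
uGo-raises {m} {j} (nothing ∷ xs) eq with uGo m (suc j) xs in run | eq
... | just _  | refl = pass-empty (uGo-raises xs run)
... | nothing | ()
uGo-raises (just zero ∷ xs) ()
uGo-raises {m} {j} (just (suc zero) ∷ xs) eq
  with shaded m 1 j in parked | uGo m (suc j) xs in run | eq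
... | true  | just _  | refl = pass-parked parked (uGo-raises xs run)
... | true  | nothing | ()
... | false | _       | ()
uGo-raises {m} {j} (just (suc (suc i)) ∷ xs) eq with shaded m (suc (suc i)) j in lower | eq
... | true  | refl = raise lower
... | false | ()

pivotColumn : ℕ → ℕ → {k : ℕ} → Vec (Maybe ℕ) k → ℕ
pivotColumn m j []                     = j
pivotColumn m j (nothing ∷ xs)         = pivotColumn m (suc j) xs
pivotColumn m j (just (suc zero) ∷ xs) = if shaded m 1 j then pivotColumn m (suc j) xs else j
pivotColumn m j (just _ ∷ xs)          = j

pivotColumn-≥ : ∀ m j {k} (xs : Vec (Maybe ℕ) k) → j ≤ pivotColumn m j xs
pivotColumn-≥ m j []                     = ≤-refl
pivotColumn-≥ m j (nothing ∷ xs)         = <⇒≤ (pivotColumn-≥ m (suc j) xs)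
pivotColumn-≥ m j (just (suc zero) ∷ xs) with shaded m 1 j
... | true  = <⇒≤ (pivotColumn-≥ m (suc j) xs)
... | false = ≤-refl
pivotColumn-≥ m j (just zero ∷ xs)          = ≤-refl
pivotColumn-≥ m j (just (suc (suc _)) ∷ xs) = ≤-refl

pivot-advances : ∀ {m j k} {T U T' U' : Vec (Maybe ℕ) k} →
  Raises m j T U → Raises m j T' U' → OnBoard m j T → OnBoard m j T' →
  Step T' U → T' ≢ T → pivotColumn m j T < pivotColumn m j T'
pivot-advances (pass-empty run) (pass-empty run') onT onT' (there step) T'≢T =
  pivot-advances run run' onT onT' step (T'≢T ∘ cong (nothing ∷_))
-- a rook of T' in row 2 below the parked rook of U
pivot-advances {j = j} (pass-parked parked _) (raise lower) _ (_ , onBoard , _) up _ =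
  ⊥-elim (not-both-shaded 1 j onBoard parked lower)
-- a rook of T' in row 1 right of the parked rook of U
pivot-advances {m} {j} (pass-parked parked _) (pass-empty (pass-parked right _)) _ (_ , onBoard , _) left _ =
  ⊥-elim (not-both-shaded 1 j onBoard parked (trans (sym (shaded-right≡below m 1 j)) right))
pivot-advances (pass-parked parked run) (pass-parked _ run') (_ , _ , onT) (_ , _ , onT') (there step) T'≢T
  rewrite parked = pivot-advances run run' onT onT' step (T'≢T ∘ cong (just 1 ∷_))
pivot-advances (raise _) _ _ _ up T'≢T = ⊥-elim (T'≢T refl)
pivot-advances {m} {j} (raise {i = i} _) _ _ _ (left {xs = rest}) _ =
  pivotColumn-≥ m (suc j) (just (suc i) ∷ rest)
-- the raised rook of U already sits on an unshaded square of T'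
pivot-advances {j = j} (raise lower) (pass-parked upper _) (_ , onBoard , _) _ (there _) _ =
  ⊥-elim (not-both-shaded 1 j onBoard upper lower)
pivot-advances {j = j} (raise lower) (raise {i = i} upper) (_ , onBoard , _) _ (there _) _ =
  ⊥-elim (not-both-shaded (suc (suc i)) j onBoard upper lower)

increasing-never-returns : (f : ℕ → ℕ) (r : ℕ) → 1 ≤ r →
  (∀ k → k < r → f k < f (suc k)) → f r ≢ f 0
increasing-never-returns f (suc r) _ increases returns =
  <-irrefl (sym returns) (above-start r ≤-refl)
  where
  above-start : ∀ k → k < suc r → f 0 < f (suc k)
  above-start zero    _   = increases 0 (s≤s z≤n)
  above-start (suc k) k<r = <-trans (above-start k (<⇒≤ k<r)) (increases (suc k) k<r)

theorem8p3 : (m n : ℕ) → ¬ (Σ ℕ λ r → Σ (ℕ → Placement m) λ T →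
    (2 ≤ r)
    × (∀ a b → a < r → b < r → T a ≡ T b → a ≡ b)
    × (T r ≡ T 0)
    × (∀ k → k < r → Σ (Placement m) λ U →
    (u m (T k) ≡ just U) × Cover m n (T k) U × Cover m n (T (suc k)) U))
theorem8p3 m n (r , T , 2≤r , injective , closed , zigzag) =
  increasing-never-returns (pivotColumn m 1 ∘ T) r 1≤r advances (cong (pivotColumn m 1) closed)
  where
  1≤r : 1 ≤ r
  1≤r = <⇒≤ 2≤r

  -- every T k with k ≤ r is matched upwards, T r = T 0 included
  matched : ∀ k → k ≤ r → Σ (Placement m) (Raises m 1 (T k))
  matched k k≤r with m≤n⇒m<n∨m≡n k≤r
  ... | inj₁ k<r  = _ , uGo-raises (T k) (proj₁ (proj₂ (zigzag k k<r)))
  ... | inj₂ refl = _ , uGo-raises (T r) (trans (cong (u m) closed) (proj₁ (proj₂ (zigzag 0 1≤r))))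

  -- consecutive elements of the cycle are distinct, as r ≥ 2
  distinct : ∀ k → k < r → T (suc k) ≢ T k
  distinct k k<r next≡ with m≤n⇒m<n∨m≡n k<r
  ... | inj₁ 1+k<r = 1+n≢n (injective (suc k) k 1+k<r k<r next≡)
  ... | inj₂ refl with injective 0 k 1≤r k<r (trans (sym closed) next≡)
  ...   | refl = 1+n≰n 2≤r

  advances : ∀ k → k < r → pivotColumn m 1 (T k) < pivotColumn m 1 (T (suc k))
  advances k k<r with zigzag k k<r
  ... | _ , uT≡U , ((onT , _) , _) , ((onT' , _) , _ , step) =
    pivot-advances (uGo-raises (T k) uT≡U) (proj₂ (matched (suc k) k<r)) onT onT' step (distinct k k<r)
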